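{- There is an absolute constant $c>0$ such that for every $n\ge1$ and every preorder sequence $S=(s_1,\dots,s_n)$ (a permutation of $[n]$ avoiding the pattern $(2,3,1)$), taking the initial tree $I_p=\mathcal{M}(S)=\{(s_i,-i): i\in[n]\}$, we have $\textsc{Greedy}_{I_p}(S)\le c\,n$; that is, $\textsc{Greedy}_{I_p}(S)=O(n)$.
   Context: A permutation $(a_1,\dots,a_n)$ avoids the pattern $(2,3,1)$ if there are no indices $i<j<k$ with $a_k<a_i<a_j$; equivalently it is the preorder traversal of some binary search tree on $[n]$. Geometric view of binary search trees: a search sequence $S=(s_1,\dots,s_n)$ is the point set $\{(s_i,i)\}$ (x = key, y = time); the mirror $\mathcal{M}(S)$ is its reflection across the $x$-axis. An initial tree is a finite set of points with negative $y$-coordinates present before any search. For two points $p,q$ not on a common horizontal or vertical line, $\square_{pq}$ denotes the closed axis-parallel rectangle with corners $p,q$. The algorithm $\textsc{Greedy}$ with initial tree $I$ on $S$: start with $X:=I$; for $i=1,\dots,n$ in order, let $X_{<i}$ be the current set (all points with $y<i$); for every point $z\in X_{<i}$ with $z.x\neq s_i$ such that $\square_{(s_i,i)z}$ contains no point of $X_{<i}\cup\{(s_i,i)\}$ other than its two corners, add the point $(z.x,i)$ (a touched point); then add $(s_i,i)$ and all these touched points to $X$. The cost $\textsc{Greedy}_I(S)$ is $n$ plus the total number of touched points added over all times $1,\dots,n$. -}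

module Defs where

open import Data.Bool using (Bool; true; false; _∧_; _∨_; not)
open import Data.Nat as ℕ using (ℕ; zero; suc; _+_)
open import Data.Integer as ℤ using (ℤ; +_; -_)
open import Data.Fin using (Fin)
import Data.Fin as Fin
open import Data.List using (List; []; _∷_; _++_; map; length; lookup; filterᵇ; deduplicate)
open import Data.Product using (_×_; _,_; proj₁; proj₂)
open import Data.Product.Properties using (≡-dec)
open import Relation.Nullary using (¬_)
open import Relation.Nullary.Decidable using (⌊_⌋)
open import Relation.Binary.PropositionalEquality using (_≡_)
open import Relation.Binary.Definitions using (DecidableEquality)

-- A point of the geometric view: (x = key, y = time).
Point : Set
Point = ℕ × ℤ

_≟P_ : DecidableEquality Point
_≟P_ = ≡-dec ℕ._≟_ ℤ._≟_

_==P_ : Point → Point → Bool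
p ==P q = ⌊ p ≟P q ⌋

inRect : Point → Point → Point → Bool
inRect (px , py) (qx , qy) (rx , ry) =
  ⌊ ℕ._≤?_ (ℕ._⊓_ px qx) rx ⌋ ∧ ⌊ ℕ._≤?_ rx (ℕ._⊔_ px qx) ⌋ ∧
  ⌊ ℤ._≤?_ (ℤ._⊓_ py qy) ry ⌋ ∧ ⌊ ℤ._≤?_ ry (ℤ._⊔_ py qy) ⌋

allᵇ : {A : Set} → (A → Bool) → List A → Bool
allᵇ f [] = true
allᵇ f (x ∷ xs) = f x ∧ allᵇ f xs

emptyRect : List Point → Point → Point → Bool
emptyRect X p z = allᵇ (λ r → not (inRect p z r) ∨ (r ==P p) ∨ (r ==P z)) (p ∷ X)

touched : List Point → Point → List Point
touched X p =
  deduplicate _≟P_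
    (map (λ z → (proj₁ z , proj₂ p))
         (filterᵇ (λ z → not ⌊ proj₁ z ℕ.≟ proj₁ p ⌋ ∧ emptyRect X p z) X))

greedyTouched : List Point → ℕ → List ℕ → ℕ
greedyTouched X t [] = 0
greedyTouched X t (s ∷ ss) =
  let p = (s , + t)
      T = touched X p
  in length T + greedyTouched (p ∷ T ++ X) (suc t) ss

greedyCost : List Point → List ℕ → ℕ
greedyCost I S = length S + greedyTouched I 1 S

mirrorFrom : ℕ → List ℕ → List Point
mirrorFrom t [] = []
mirrorFrom t (s ∷ ss) = (s , - (+ t)) ∷ mirrorFrom (suc t) ss

mirror : List ℕ → List Point
mirror = mirrorFrom 1

Avoids231 : List ℕ → Set
Avoids231 S = (i j k : Fin (length S)) → i Fin.< j → j Fin.< k →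
  ¬ ((lookup S k ℕ.< lookup S i) × (lookup S i ℕ.< lookup S j))

-- At time t, when s is searched, only keys searched before can be touched: the mirror
-- point (s, -t) lies in the rectangle towards the mirror point of any later key.
-- Among searched keys a < b lying above the next search, column a covers column b
-- (it has a point at least as late as every point of column b), so the rectangle
-- towards b contains a point of column a: at most one key above s is touched.
-- Below s, let g be the largest touched key.  From now on column g covers every
-- column b < g, and by 231-avoidance no later search is smaller than g, so every
-- b < g is dead: it is never touched again.  Thus each search touches at most two
-- keys besides keys that die at that moment, every key dies at most once, and
-- Greedy touches at most 3n points in total.

{-# OPTIONS --safe #-}
module Submission where

open import Defs
open import Data.Nat using (ℕ; _≤_; _<_; _*_; suc)
open import Data.List using (List; applyUpTo)
open import Data.List.Relation.Binary.Permutation.Propositional using (_↭_)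
open import Data.Product using (∃-syntax; _×_)

open import Data.Bool using (Bool; true; false; _∧_; _∨_; not; T)
open import Data.Bool.Properties using (T-∧)
open import Data.Empty using (⊥; ⊥-elim)
open import Data.Fin as Fin using (Fin)
open import Data.Nat using (_+_; _⊓_; _⊔_; z≤n; s≤s; _≟_; _≤?_; _<?_)
open import Data.Integer as ℤ using (+_; -_)
import Data.Integer.Properties as ℤₚ
open import Data.List using ([]; _∷_; _++_; map; length; filter; lookup)
open import Data.List.Properties using (length-++; length-map; length-applyUpTo)
open import Data.List.Membership.Propositional using (_∈_; _∉_; lose; find)
open import Data.List.Membership.Propositional.Properties
  using (∈-map⁺; ∈-map⁻; ∈-filter⁺; ∈-filter⁻; ∈-deduplicate⁻
        ; ∈-++⁺ˡ; ∈-++⁺ʳ; ∈-++⁻; ∈-∃++)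
open import Data.List.Membership.DecPropositional _≟_ using (_∈?_)
open import Data.List.Relation.Binary.Subset.Propositional using (_⊆_)
open import Data.List.Relation.Binary.Permutation.Propositional.Properties using (↭-length)
open import Data.List.Relation.Unary.All as All using (All; []; _∷_)
import Data.List.Relation.Unary.All.Properties as Allₚ
open import Data.List.Relation.Unary.AllPairs using ([]; _∷_)
open import Data.List.Relation.Unary.Any as Any using (Any; here; there; any?)
open import Data.List.Relation.Unary.Any.Properties using (lookup-index)
open import Data.List.Relation.Unary.Unique.Propositional using (Unique)
import Data.List.Relation.Unary.Unique.Propositional.Properties as Unique
open import Data.List.Relation.Unary.Unique.DecPropositional.Properties using (deduplicate-!)
open import Data.Nat.Properties
  using ( ≤-trans; <⇒≤; <⇒≢; >⇒≢; <⇒≱; ≮⇒≥; ≤∧≢⇒<; <-cmp; <-trans; n≤1+n; n<1+n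
        ; +-suc; +-comm; +-mono-≤; +-monoˡ-≤; +-monoʳ-≤; m⊓n≤m; m⊓n≤n; m≤m⊔n; m≤n⊔m
        ; module ≤-Reasoning)
open import Data.Nat.Solver using (module +-*-Solver)
open import Data.Product using (proj₁; proj₂; _,_)
open import Data.Product.Properties using (×-≡,≡→≡)
open import Data.Sum using (_⊎_; inj₁; inj₂)
open import Data.Unit using (⊤; tt)
open import Function using (_∘_; id)
open import Function.Bundles using (Equivalence)
open import Relation.Binary.Definitions using (tri<; tri≈; tri>)
open import Relation.Binary.PropositionalEquality using (_≡_; _≢_; refl; sym; trans; cong; subst)
open import Relation.Nullary using (¬_; Dec; yes; no)
open import Relation.Nullary.Decidable
  using (⌊_⌋; ¬?; _×-dec_; T?; dec-true; dec-false; isYes≗does; toWitnessFalse)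
open import Relation.Unary using (Decidable)

module _ {A : Set} where

  length-filter-complement : ∀ {P : A → Set} (P? : Decidable P) xs →
    length (filter P? xs) + length (filter (¬? ∘ P?) xs) ≡ length xs
  length-filter-complement P? [] = refl
  length-filter-complement P? (x ∷ xs) with P? x
  ... | yes _ = cong suc (length-filter-complement P? xs)
  ... | no  _ = trans (+-suc _ _) (cong suc (length-filter-complement P? xs))

  Unique-⊆⇒length-≤ : ∀ {xs ys : List A} → Unique xs → xs ⊆ ys → length xs ≤ length ys
  Unique-⊆⇒length-≤ {[]} _ _ = z≤n
  Unique-⊆⇒length-≤ {x ∷ xs} (x∉xs ∷ xs!) xs⊆ys with ∈-∃++ (xs⊆ys (here refl))
  ... | as , bs , refl = begin
      suc (length xs)              ≤⟨ s≤s (Unique-⊆⇒length-≤ xs! xs⊆as++bs) ⟩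
      suc (length (as ++ bs))      ≡⟨ cong suc (length-++ as) ⟩
      suc (length as + length bs)  ≡⟨ sym (+-suc (length as) (length bs)) ⟩
      length as + length (x ∷ bs)  ≡⟨ sym (length-++ as) ⟩
      length (as ++ x ∷ bs)        ∎
    where
    open ≤-Reasoning
    xs⊆as++bs : xs ⊆ as ++ bs
    xs⊆as++bs {y} y∈xs with ∈-++⁻ as (xs⊆ys (there y∈xs))
    ... | inj₁ y∈as         = ∈-++⁺ˡ y∈as
    ... | inj₂ (here y≡x)   = ⊥-elim (All.lookup x∉xs y∈xs (sym y≡x))
    ... | inj₂ (there y∈bs) = ∈-++⁺ʳ as y∈bs

  Unique-constant⇒length≤1 : ∀ {xs : List A} → Unique xs →
    (∀ {a b} → a ∈ xs → b ∈ xs → a ≡ b) → length xs ≤ 1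
  Unique-constant⇒length≤1 {[]} _ _ = z≤n
  Unique-constant⇒length≤1 {x ∷ _} xs! constant =
    Unique-⊆⇒length-≤ {ys = x ∷ []} xs! (λ y∈xs → here (constant y∈xs (here refl)))

Unique-map-proj₁ : ∀ {A B : Set} {c : B} {xs : List (A × B)} →
  All (λ w → proj₂ w ≡ c) xs → Unique xs → Unique (map proj₁ xs)
Unique-map-proj₁ [] [] = []
Unique-map-proj₁ {c = c} {w ∷ _} (w≡c ∷ ws≡c) (w∉ws ∷ ws!) =
  Allₚ.map⁺ (All.zipWith keys-differ (w∉ws , ws≡c)) ∷ Unique-map-proj₁ ws≡c ws!
  where
  keys-differ : ∀ {v} → w ≢ v × proj₂ v ≡ c → proj₁ w ≢ proj₁ v
  keys-differ (w≢v , v≡c) same-key = w≢v (×-≡,≡→≡ (same-key , trans w≡c (sym v≡c)))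

⌊⌋-true : ∀ {P : Set} (P? : Dec P) → P → ⌊ P? ⌋ ≡ true
⌊⌋-true P? p = trans (isYes≗does P?) (dec-true P? p)

⌊⌋-false : ∀ {P : Set} (P? : Dec P) → ¬ P → ⌊ P? ⌋ ≡ false
⌊⌋-false P? ¬p = trans (isYes≗does P?) (dec-false P? ¬p)

allᵇ-T : ∀ {A : Set} {f : A → Bool} {x xs} → T (allᵇ f xs) → x ∈ xs → T (f x)
allᵇ-T {xs = _ ∷ _} all-f (here refl)  = proj₁ (Equivalence.to T-∧ all-f)
allᵇ-T {xs = _ ∷ _} all-f (there x∈xs) = allᵇ-T (proj₂ (Equivalence.to T-∧ all-f)) x∈xs

Between : ℕ → ℕ → ℕ → Set
Between a b x = a ⊓ b ≤ x × x ≤ a ⊔ b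

between-≤ : ∀ {a b x} → a ≤ x → x ≤ b → Between a b x
between-≤ {a} {b} a≤x x≤b = ≤-trans (m⊓n≤m a b) a≤x , ≤-trans x≤b (m≤n⊔m a b)

between-≥ : ∀ {a b x} → b ≤ x → x ≤ a → Between a b x
between-≥ {a} {b} b≤x x≤a = ≤-trans (m⊓n≤n a b) b≤x , ≤-trans x≤a (m≤m⊔n a b)

between-left : ∀ {a b} → Between a b a
between-left {a} {b} = m⊓n≤m a b , m≤m⊔n a b

inRect-true : ∀ {s t} z r → Between s (proj₁ z) (proj₁ r) →
  proj₂ z ℤ.≤ proj₂ r → proj₂ r ℤ.≤ + t → inRect (s , + t) z r ≡ true
inRect-true {s} {t} (zx , zy) (rx , ry) (low , high) zy≤ry ry≤t
  rewrite ⌊⌋-true (s ⊓ zx ≤? rx) low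
        | ⌊⌋-true (rx ≤? s ⊔ zx) high
        | ⌊⌋-true ((+ t) ℤ.⊓ zy ℤ.≤? ry) (ℤₚ.≤-trans (ℤₚ.i⊓j≤j (+ t) zy) zy≤ry)
        | ⌊⌋-true (ry ℤ.≤? (+ t) ℤ.⊔ zy) (ℤₚ.≤-trans ry≤t (ℤₚ.i≤i⊔j (+ t) zy))
  = refl

emptyRect-blocked : ∀ {X s t z r} → T (emptyRect X (s , + t) z) → r ∈ X →
  proj₁ r ≢ proj₁ z → proj₂ r ℤ.< + t → Between s (proj₁ z) (proj₁ r) →
  proj₂ z ℤ.≤ proj₂ r → ⊥
emptyRect-blocked {X} {s} {t} {z} {r} empty r∈X r≉z r<t r-between z≤r =
  subst T r-inside (allᵇ-T empty (there r∈X))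
  where
  r-inside : (not (inRect (s , + t) z r) ∨ (r ==P (s , + t)) ∨ (r ==P z)) ≡ false
  r-inside rewrite inRect-true z r r-between z≤r (ℤₚ.<⇒≤ r<t)
                 | ⌊⌋-false (r ≟P (s , + t)) (λ r≡p → ℤₚ.<-irrefl (cong proj₂ r≡p) r<t)
                 | ⌊⌋-false (r ≟P z) (r≉z ∘ cong proj₁)
                 = refl

record Touched (X : List Point) (s t k : ℕ) : Set where
  constructor touched-by
  field
    witness     : Point
    witness∈X   : witness ∈ X
    witness-key : proj₁ witness ≡ k
    key≢search  : k ≢ s
    empty       : T (emptyRect X (s , + t) witness)

touchedKeys : List Point → ℕ → ℕ → List ℕ
touchedKeys X s t = map proj₁ (touched X (s , + t))

Touchable : List Point → ℕ → ℕ → Point → Bool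
Touchable X s t z = not ⌊ proj₁ z ≟ s ⌋ ∧ emptyRect X (s , + t) z

∈-touched⁻ : ∀ X s t {w} → w ∈ touched X (s , + t) → Touched X s t (proj₁ w) × proj₂ w ≡ + t
∈-touched⁻ X s t w∈
  with z , z∈ , refl ← ∈-map⁻ (λ z → proj₁ z , + t) (∈-deduplicate⁻ _≟P_ _ w∈)
  with z∈X , z-touchable ← ∈-filter⁻ (T? ∘ Touchable X s t) {xs = X} z∈
  with key≢s , empty ← Equivalence.to (T-∧ {not ⌊ proj₁ z ≟ s ⌋}) z-touchable
  = touched-by z z∈X refl (toWitnessFalse key≢s) empty , refl

touchedKey⁻ : ∀ X s t {k} → k ∈ touchedKeys X s t → Touched X s t k
touchedKey⁻ X s t k∈ with ∈-map⁻ proj₁ k∈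
... | w , w∈ , refl = proj₁ (∈-touched⁻ X s t w∈)

touchedKey-point : ∀ X s t {k} → k ∈ touchedKeys X s t → (k , + t) ∈ touched X (s , + t)
touchedKey-point X s t k∈ with ∈-map⁻ proj₁ k∈
... | w , w∈ , refl with proj₂ (∈-touched⁻ X s t w∈)
... | refl = w∈

touchedKeys-unique : ∀ X s t → Unique (touchedKeys X s t)
touchedKeys-unique X s t =
  Unique-map-proj₁ (All.tabulate (proj₂ ∘ ∈-touched⁻ X s t)) (deduplicate-! _≟P_ _)

mirrorFrom-time : ∀ {u l z} → z ∈ mirrorFrom u l → proj₂ z ℤ.≤ - (+ u)
mirrorFrom-time {l = _ ∷ _} (here refl) = ℤₚ.≤-refl
mirrorFrom-time {u} {l = _ ∷ _} (there z∈) =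
  ℤₚ.≤-trans (mirrorFrom-time z∈) (ℤₚ.neg-mono-≤ (ℤ.+≤+ (n≤1+n u)))

No231From : ℕ → List ℕ → Set
No231From b []      = ⊤
No231From b (y ∷ l) = (b < y → All (b ≤_) l) × No231From b l

Avoids231ᴸ : List ℕ → Set
Avoids231ᴸ []      = ⊤
Avoids231ᴸ (a ∷ l) = No231From a l × Avoids231ᴸ l

No231From-lookup : ∀ b l →
  (∀ (j k : Fin (length l)) → j Fin.< k → ¬ (lookup l k < b × b < lookup l j)) → No231From b l
No231From-lookup b [] _ = tt
No231From-lookup b (y ∷ l) no-pattern =
  later-above , No231From-lookup b l (λ j k j<k → no-pattern (Fin.suc j) (Fin.suc k) (s≤s j<k))
  where
  later-above : b < y → All (b ≤_) l
  later-above b<y = All.tabulate λ k∈l → ≮⇒≥ λ k<b →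
    no-pattern Fin.zero (Fin.suc (Any.index k∈l)) (s≤s z≤n)
      (subst (_< b) (lookup-index k∈l) k<b , b<y)

avoids231⇒ᴸ : ∀ {xs} → Avoids231 xs → Avoids231ᴸ xs
avoids231⇒ᴸ {[]} _ = tt
avoids231⇒ᴸ {a ∷ xs} avoids =
  No231From-lookup a xs (λ j k j<k → avoids Fin.zero (Fin.suc j) (Fin.suc k) (s≤s z≤n) (s≤s j<k)) ,
  avoids231⇒ᴸ (λ i j k i<j j<k → avoids (Fin.suc i) (Fin.suc j) (Fin.suc k) (s≤s i<j) (s≤s j<k))

Covers : List Point → ℕ → ℕ → Set
Covers X a b =
  ∀ {z} → z ∈ X → proj₁ z ≡ b → ∃[ w ] (w ∈ X × proj₁ w ≡ a × proj₂ z ℤ.≤ proj₂ w)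

Dead : List Point → List ℕ → ℕ → Set
Dead X ss b = ∃[ g ] (b < g × Covers X g b × All (g ≤_) ss)

-- The state of Greedy before time t: X is the current point set, B the keys searched so
-- far, ss the searches still to come and Q the keys still alive; |Q| is the potential
-- that pays for touched keys in excess of two per search.
record Invariant (X : List Point) (t : ℕ) (B ss Q : List ℕ) : Set where
  field
    before-now         : ∀ {z} → z ∈ X → proj₂ z ℤ.< + t
    searched-or-mirror : ∀ {z} → z ∈ X → proj₁ z ∈ B ⊎ z ∈ mirrorFrom t ss
    mirror⊆X           : mirrorFrom t ss ⊆ X
    covered-above      : ∀ {s a b} → s ∈ ss → a ∈ B → b ∈ B → s < a → a < b → Covers X a b
    dead-unless-alive  : ∀ {b} → b ∈ B → b ∉ Q → Dead X ss b
    future-alive       : ss ⊆ Q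
    history-avoids     : ∀ {b} → b ∈ B → No231From b ss
    future-avoids      : Avoids231ᴸ ss

module Step {X : List Point} {t s : ℕ} {B rest Q : List ℕ}
            (inv : Invariant X t B (s ∷ rest) Q) where
  open Invariant inv

  p : Point
  p = s , + t

  touchedNow : List Point
  touchedNow = touched X p

  K : List ℕ
  K = touchedKeys X s t

  X′ : List Point
  X′ = p ∷ touchedNow ++ X

  touched-unblocked : ∀ {k} (h : Touched X s t k) {w} → w ∈ X → proj₁ w ≢ k →
    Between s k (proj₁ w) → proj₂ (Touched.witness h) ℤ.≤ proj₂ w → ⊥
  touched-unblocked (touched-by z _ refl _ empty) w∈X w≉z w-between z≤w =
    emptyRect-blocked empty w∈X w≉z (before-now w∈X) w-between z≤w

  -- The search's own mirror point (s, -t) blocks every later mirror point.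
  touched⇒searched : ∀ {k} → k ∈ K → k ∈ B
  touched⇒searched k∈K with touchedKey⁻ X s t k∈K
  ... | h@(touched-by z z∈X refl k≢s _) with searched-or-mirror z∈X
  ... | inj₁ k∈B              = k∈B
  ... | inj₂ (here refl)      = ⊥-elim (k≢s refl)
  ... | inj₂ (there z∈future) =
    ⊥-elim (touched-unblocked h (mirror⊆X (here refl)) (k≢s ∘ sym) between-left z-earlier)
    where
    z-earlier : proj₂ z ℤ.≤ - (+ t)
    z-earlier = ℤₚ.≤-trans (mirrorFrom-time z∈future) (ℤₚ.neg-mono-≤ (ℤ.+≤+ (n≤1+n t)))

  untouched-behind : ∀ {a b} → a ∈ B → s < a → a < b → b ∉ K
  untouched-behind a∈B s<a a<b b∈K with touchedKey⁻ X s t b∈K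
  ... | h@(touched-by z z∈X refl _ _)
    with w , w∈X , refl , z≤w ← covered-above (here refl) a∈B (touched⇒searched b∈K) s<a a<b z∈X refl
    = touched-unblocked h w∈X (<⇒≢ a<b) (between-≤ (<⇒≤ s<a) (<⇒≤ a<b)) z≤w

  dead-untouched : ∀ {b} → Dead X (s ∷ rest) b → b ∉ K
  dead-untouched (g , b<g , covers , g≤future) b∈K with touchedKey⁻ X s t b∈K
  ... | h@(touched-by z z∈X refl _ _) with w , w∈X , refl , z≤w ← covers z∈X refl =
    touched-unblocked h w∈X (>⇒≢ b<g) (between-≥ (<⇒≤ b<g) (All.head g≤future)) z≤w

  touched⇒alive : ∀ {b} → b ∈ K → b ∈ Q
  touched⇒alive {b} b∈K with b ∈? Q
  ... | yes b∈Q = b∈Q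
  ... | no  b∉Q = ⊥-elim (dead-untouched (dead-unless-alive (touched⇒searched b∈K) b∉Q) b∈K)

  Shadowed : ℕ → Set
  Shadowed b = Any (λ g → b < g × g < s) K

  shadowed? : Decidable Shadowed
  shadowed? b = any? (λ g → b <? g ×-dec g <? s) K

  shadowing-key : ∀ {b} → Shadowed b → ∃[ g ] (g ∈ K × b < g × All (g ≤_) rest)
  shadowing-key b-shadowed with g , g∈K , b<g , g<s ← find b-shadowed =
    g , g∈K , b<g , proj₁ (history-avoids (touched⇒searched g∈K)) g<s

  Q′ : List ℕ
  Q′ = filter (¬? ∘ shadowed?) Q

  Unshadowed : List ℕ
  Unshadowed = filter (¬? ∘ shadowed?) K

  Unshadowed-unique : Unique Unshadowed
  Unshadowed-unique = Unique.filter⁺ (¬? ∘ shadowed?) (touchedKeys-unique X s t)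

  UnshadowedBelow UnshadowedAbove : List ℕ
  UnshadowedBelow = filter (_<? s) Unshadowed
  UnshadowedAbove = filter (¬? ∘ (_<? s)) Unshadowed

  unshadowed-below≤1 : length UnshadowedBelow ≤ 1
  unshadowed-below≤1 =
    Unique-constant⇒length≤1 (Unique.filter⁺ (_<? s) Unshadowed-unique) same
    where
    below⁻ : ∀ {a} → a ∈ UnshadowedBelow → a ∈ K × ¬ Shadowed a × a < s
    below⁻ a∈
      with a∈U , a<s ← ∈-filter⁻ (_<? s) a∈
      with a∈K , a-free ← ∈-filter⁻ (¬? ∘ shadowed?) a∈U
      = a∈K , a-free , a<s
    same : ∀ {a b} → a ∈ UnshadowedBelow → b ∈ UnshadowedBelow → a ≡ b
    same a∈ b∈
      with a∈K , a-free , a<s ← below⁻ a∈ | b∈K , b-free , b<s ← below⁻ b∈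
      with <-cmp _ _
    ... | tri< a<b _ _ = ⊥-elim (a-free (lose b∈K (a<b , b<s)))
    ... | tri≈ _ a≡b _ = a≡b
    ... | tri> _ _ b<a = ⊥-elim (b-free (lose a∈K (b<a , a<s)))

  unshadowed-above≤1 : length UnshadowedAbove ≤ 1
  unshadowed-above≤1 =
    Unique-constant⇒length≤1 (Unique.filter⁺ (¬? ∘ (_<? s)) Unshadowed-unique) same
    where
    above⁻ : ∀ {a} → a ∈ UnshadowedAbove → a ∈ K × s < a
    above⁻ a∈
      with a∈U , a≮s ← ∈-filter⁻ (¬? ∘ (_<? s)) a∈
      with a∈K , _ ← ∈-filter⁻ (¬? ∘ shadowed?) a∈U
      = a∈K , ≤∧≢⇒< (≮⇒≥ a≮s) (Touched.key≢search (touchedKey⁻ X s t a∈K) ∘ sym)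
    same : ∀ {a b} → a ∈ UnshadowedAbove → b ∈ UnshadowedAbove → a ≡ b
    same a∈ b∈ with a∈K , s<a ← above⁻ a∈ | b∈K , s<b ← above⁻ b∈ with <-cmp _ _
    ... | tri< a<b _ _ = ⊥-elim (untouched-behind (touched⇒searched a∈K) s<a a<b b∈K)
    ... | tri≈ _ a≡b _ = a≡b
    ... | tri> _ _ b<a = ⊥-elim (untouched-behind (touched⇒searched b∈K) s<b b<a a∈K)

  unshadowed-touched≤2 : length Unshadowed ≤ 2
  unshadowed-touched≤2 = begin
    length Unshadowed
      ≡⟨ sym (length-filter-complement (_<? s) Unshadowed) ⟩
    length UnshadowedBelow + length UnshadowedAbove
      ≤⟨ +-mono-≤ unshadowed-below≤1 unshadowed-above≤1 ⟩
    2 ∎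
    where open ≤-Reasoning

  shadowed-touched⊆shadowed-alive : filter shadowed? K ⊆ filter shadowed? Q
  shadowed-touched⊆shadowed-alive b∈ with b∈K , b-shadowed ← ∈-filter⁻ shadowed? b∈ =
    ∈-filter⁺ shadowed? (touched⇒alive b∈K) b-shadowed

  step-cost : length touchedNow + length Q′ ≤ 2 + length Q
  step-cost = begin
    length touchedNow + length Q′
      ≡⟨ cong (_+ length Q′) (sym (length-map proj₁ touchedNow)) ⟩
    length K + length Q′
      ≡⟨ cong (_+ length Q′) (sym (length-filter-complement shadowed? K)) ⟩
    length (filter shadowed? K) + length Unshadowed + length Q′
      ≤⟨ +-monoˡ-≤ (length Q′) (+-mono-≤ shadowed-touched≤ unshadowed-touched≤2) ⟩
    length (filter shadowed? Q) + 2 + length Q′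
      ≡⟨ cong (_+ length Q′) (+-comm (length (filter shadowed? Q)) 2) ⟩
    2 + (length (filter shadowed? Q) + length Q′)
      ≡⟨ cong (λ m → 2 + m) (length-filter-complement shadowed? Q) ⟩
    2 + length Q ∎
    where
    open ≤-Reasoning
    shadowed-touched≤ : length (filter shadowed? K) ≤ length (filter shadowed? Q)
    shadowed-touched≤ = Unique-⊆⇒length-≤ (Unique.filter⁺ shadowed? (touchedKeys-unique X s t))
                                          shadowed-touched⊆shadowed-alive

  ∈-X′⁻ : ∀ {z} → z ∈ X′ → z ≡ p ⊎ (proj₁ z ∈ K × proj₂ z ≡ + t) ⊎ z ∈ X
  ∈-X′⁻ (here z≡p) = inj₁ z≡p
  ∈-X′⁻ (there z∈) with ∈-++⁻ touchedNow z∈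
  ... | inj₁ z∈new = inj₂ (inj₁ (∈-map⁺ proj₁ z∈new , proj₂ (∈-touched⁻ X s t z∈new)))
  ... | inj₂ z∈X  = inj₂ (inj₂ z∈X)

  X⊆X′ : X ⊆ X′
  X⊆X′ = there ∘ ∈-++⁺ʳ touchedNow

  X′-until-now : ∀ {z} → z ∈ X′ → proj₂ z ℤ.≤ + t
  X′-until-now z∈ with ∈-X′⁻ z∈
  ... | inj₁ refl               = ℤₚ.≤-refl
  ... | inj₂ (inj₁ (_ , z-now)) = ℤₚ.≤-reflexive z-now
  ... | inj₂ (inj₂ z∈X)         = ℤₚ.<⇒≤ (before-now z∈X)

  covered-by-now : ∀ {w b} → w ∈ X′ → proj₂ w ≡ + t → Covers X′ (proj₁ w) b
  covered-by-now {w} w∈ w-now z∈ _ = w , w∈ , refl , subst (_ ℤ.≤_) (sym w-now) (X′-until-now z∈)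

  covers-preserved : ∀ {a b} → b ≢ s → b ∉ K → Covers X a b → Covers X′ a b
  covers-preserved b≢s b∉K covers z∈ refl with ∈-X′⁻ z∈
  ... | inj₁ refl                 = ⊥-elim (b≢s refl)
  ... | inj₂ (inj₁ (b∈K , _))     = ⊥-elim (b∉K b∈K)
  ... | inj₂ (inj₂ z∈X) with w , w∈X , w-key , z≤w ← covers z∈X refl =
    w , X⊆X′ w∈X , w-key , z≤w

  shadowed⇒dead : ∀ {b} → Shadowed b → Dead X′ rest b
  shadowed⇒dead b-shadowed with g , g∈K , b<g , g≤future ← shadowing-key b-shadowed =
    g , b<g , covered-by-now (there (∈-++⁺ˡ (touchedKey-point X s t g∈K))) refl , g≤future

  dead-preserved : ∀ {b} → Dead X (s ∷ rest) b → Dead X′ rest b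
  dead-preserved {b} dead@(g , b<g , covers , g≤future) =
    g , b<g , covers-preserved b≢s (dead-untouched dead) covers , All.tail g≤future
    where
    b≢s : b ≢ s
    b≢s refl = <⇒≱ b<g (All.head g≤future)

  covered-above′ : ∀ {s′ a b} → s′ ∈ rest → a ∈ s ∷ B → b ∈ s ∷ B → s′ < a → a < b →
    Covers X′ a b
  covered-above′ _ (here refl) _ _ _ = covered-by-now (here refl) refl
  covered-above′ {a = a} {b} s′∈rest (there a∈B) b∈ s′<a a<b with <-cmp a s
  ... | tri< a<s _ _ = ⊥-elim (<⇒≱ s′<a (All.lookup (proj₁ (history-avoids a∈B) a<s) s′∈rest))
  ... | tri≈ _ refl _ = covered-by-now (here refl) refl
  ... | tri> _ _ s<a =
    covers-preserved b≢s (untouched-behind a∈B s<a a<b)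
      (covered-above (here refl) a∈B (Any.tail b≢s b∈) s<a a<b)
    where
    b≢s : b ≢ s
    b≢s = >⇒≢ (<-trans s<a a<b)

  dead-unless-alive′ : ∀ {b} → b ∈ s ∷ B → b ∉ Q′ → Dead X′ rest b
  dead-unless-alive′ {b} b∈ b∉Q′ with shadowed? b
  ... | yes b-shadowed = shadowed⇒dead b-shadowed
  ... | no  b-free with b ∈? Q
  ...   | yes b∈Q = ⊥-elim (b∉Q′ (∈-filter⁺ (¬? ∘ shadowed?) b∈Q b-free))
  ...   | no  b∉Q = dead-preserved (dead-unless-alive (Any.tail b≢s b∈) b∉Q)
    where
    b≢s : b ≢ s
    b≢s refl = b∉Q (future-alive (here refl))

  future-alive′ : rest ⊆ Q′
  future-alive′ {k} k∈rest = ∈-filter⁺ (¬? ∘ shadowed?) (future-alive (there k∈rest)) unshadowed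
    where
    unshadowed : ¬ Shadowed k
    unshadowed k-shadowed with _ , _ , k<g , g≤future ← shadowing-key k-shadowed =
      <⇒≱ k<g (All.lookup g≤future k∈rest)

  searched-or-mirror′ : ∀ {z} → z ∈ X′ → proj₁ z ∈ s ∷ B ⊎ z ∈ mirrorFrom (suc t) rest
  searched-or-mirror′ z∈ with ∈-X′⁻ z∈
  ... | inj₁ refl               = inj₁ (here refl)
  ... | inj₂ (inj₁ (k∈K , _))   = inj₁ (there (touched⇒searched k∈K))
  ... | inj₂ (inj₂ z∈X) with searched-or-mirror z∈X
  ...   | inj₁ k∈B              = inj₁ (there k∈B)
  ...   | inj₂ (here refl)      = inj₁ (here refl)
  ...   | inj₂ (there z∈future) = inj₂ z∈future

  history-avoids′ : ∀ {b} → b ∈ s ∷ B → No231From b rest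
  history-avoids′ (here refl) = proj₁ future-avoids
  history-avoids′ (there b∈B) = proj₂ (history-avoids b∈B)

  invariant′ : Invariant X′ (suc t) (s ∷ B) rest Q′
  invariant′ = record
    { before-now         = λ z∈ → ℤₚ.≤-<-trans (X′-until-now z∈) (ℤ.+<+ (n<1+n t))
    ; searched-or-mirror = searched-or-mirror′
    ; mirror⊆X           = X⊆X′ ∘ mirror⊆X ∘ there
    ; covered-above      = covered-above′
    ; dead-unless-alive  = dead-unless-alive′
    ; future-alive       = future-alive′
    ; history-avoids     = history-avoids′
    ; future-avoids      = proj₂ future-avoids
    }

greedyTouched-bound : ∀ {X t B Q} ss → Invariant X t B ss Q →
  greedyTouched X t ss ≤ 2 * length ss + length Q
greedyTouched-bound [] _ = z≤n
greedyTouched-bound {X} {t} {Q = Q} (s ∷ rest) inv = begin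
  length touchedNow + greedyTouched X′ (suc t) rest
    ≤⟨ +-monoʳ-≤ (length touchedNow) (greedyTouched-bound rest invariant′) ⟩
  length touchedNow + (2 * length rest + length Q′)
    ≡⟨ solve 3 (λ a r b → a :+ (con 2 :* r :+ b) := con 2 :* r :+ (a :+ b)) refl
             (length touchedNow) (length rest) (length Q′) ⟩
  2 * length rest + (length touchedNow + length Q′)
    ≤⟨ +-monoʳ-≤ (2 * length rest) step-cost ⟩
  2 * length rest + (2 + length Q)
    ≡⟨ solve 2 (λ r q → con 2 :* r :+ (con 2 :+ q) := con 2 :* (con 1 :+ r) :+ q) refl
             (length rest) (length Q) ⟩
  2 * suc (length rest) + length Q ∎
  where
  open Step inv
  open ≤-Reasoning
  open +-*-Solver

initial-invariant : ∀ {S} → Avoids231 S → Invariant (mirror S) 1 [] S S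
initial-invariant avoids = record
  { before-now         = λ z∈ → ℤₚ.≤-<-trans (mirrorFrom-time z∈) ℤ.-<+
  ; searched-or-mirror = inj₂
  ; mirror⊆X           = id
  ; covered-above      = λ _ ()
  ; dead-unless-alive  = λ ()
  ; future-alive       = id
  ; history-avoids     = λ ()
  ; future-avoids      = avoids231⇒ᴸ avoids
  }

greedyCost-mirror≤4*length : ∀ S → Avoids231 S → greedyCost (mirror S) S ≤ 4 * length S
greedyCost-mirror≤4*length S avoids = begin
  length S + greedyTouched (mirror S) 1 S
    ≤⟨ +-monoʳ-≤ (length S) (greedyTouched-bound S (initial-invariant avoids)) ⟩
  length S + (2 * length S + length S)
    ≡⟨ solve 1 (λ n → n :+ (con 2 :* n :+ n) := con 4 :* n) refl (length S) ⟩
  4 * length S ∎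
  where
  open ≤-Reasoning
  open +-*-Solver

theorem1 : ∃[ c ] (0 < c × ((n : ℕ) → 1 ≤ n → (S : List ℕ) → S ↭ applyUpTo suc n → Avoids231 S → greedyCost (mirror S) S ≤ c * n))
theorem1 = 4 , s≤s z≤n , λ n _ S S↭1…n avoids →
  subst (λ m → greedyCost (mirror S) S ≤ 4 * m)
        (trans (↭-length S↭1…n) (length-applyUpTo suc n))
        (greedyCost-mirror≤4*length S avoids)
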